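{- Fix $h,k>0$. A set $S$ belongs to $\mathbb{S}(h,k)$ if and only if $S=\mathrm{pr}(P)$ for some nonempty $P\subseteq\mathcal{P}(h,k)$ whose profile $\mathrm{pr}(P)$ is a staircase. Equivalently, $\mathbb{S}(h,k)$ equals the set of profiles of those profile classes of nonempty subsets of $\mathcal{P}(h,k)$ whose profile is a staircase.
   Context: A partition is a weakly decreasing sequence $\sigma=(\sigma_1,\sigma_2,\ldots)$ of nonnegative integers with finitely many positive terms, with the convention $\sigma_\infty=0$, indices ranging over $[1,\infty]$ (positive integers together with the symbol $\infty$). $\mathcal{P}(h,k)$ is the set of partitions with at most $h$ positive parts and largest part exactly $k$. For $p\ge0$, the $p$-interval of $\sigma$ is $\{i\in[1,\infty]:\sigma_i=p\}$. For a nonempty finite set $P$ of partitions and $p\ge0$, let $M_p$ be the set of all nonempty $p$-intervals of members of $P$, ordered by inclusion; $\mathrm{pr}_p(P)=\{(p,I): I \text{ maximal in } M_p\}$ and the profile is $\mathrm{pr}(P)=\bigcup_{p\ge0}\mathrm{pr}_p(P)$. Two nonempty finite sets of partitions are profile-equivalent if they have the same profile; equivalence classes are profile classes. For $h,k>0$, an $(\ell,k)$-staircase is a set $S=\{(p_1,[a_1,b_1]),\ldots,(p_{s+1},[a_{s+1},b_{s+1}])\}$ with (i) $k=p_1>p_2>\cdots>p_{s+1}=0$; (ii) $a_1=1$, $a_2\ne1$, $a_i\le b_i$, $b_{s+1}=\infty$; (iii) for each $i\ge2$, $a_i=b_{i-1}$ or $a_i=b_{i-1}+1$; its length is $\ell=b_s$.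 A set is a staircase if it is an $(\ell,k)$-staircase for some $\ell$ and some $k>0$. $\mathbb{S}(h,k)$ is the set of $(\ell,k)$-staircases (with this $k$) of length at most $h$. -}

module Defs where

open import Data.Nat using (ℕ; zero; suc; _≤_; _<_; _⊔_)
open import Data.List using (List; []; _∷_; length; foldr)
open import Data.List.Relation.Unary.All using (All)
open import Data.List.Relation.Unary.Linked using (Linked)
open import Data.List.Membership.Propositional using (_∈_)
open import Data.Product using (Σ; ∃; _×_; _,_)
open import Data.Sum using (_⊎_)
open import Relation.Binary.PropositionalEquality using (_≡_; _≢_)
open import Data.Nat using (_≥_)

-- Extended naturals ℕ ∪ {∞}.  The index set [1,∞] of the paper is
-- { fin i | i ≥ 1 } ∪ { ∞ }  (see ValidIdx).

data Ext : Set where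
  fin : ℕ → Ext
  ∞   : Ext

data _≤ᵉ_ : Ext → Ext → Set where
  fin≤fin : ∀ {m n} → m ≤ n → fin m ≤ᵉ fin n
  _≤∞     : ∀ x → x ≤ᵉ ∞

sucᵉ : Ext → Ext
sucᵉ (fin n) = fin (suc n)
sucᵉ ∞       = ∞

data ValidIdx : Ext → Set where
  fin-valid : ∀ n → ValidIdx (fin (suc n))
  ∞-valid   : ValidIdx ∞

_⊆ₛ_ : {A : Set} → (A → Set) → (A → Set) → Set
X ⊆ₛ Y = ∀ x → X x → Y x

_≐_ : {A : Set} → (A → Set) → (A → Set) → Set
X ≐ Y = (X ⊆ₛ Y) × (Y ⊆ₛ X)

-- Partitions: the list of positive parts σ₁ ≥ σ₂ ≥ ... ≥ σₙ > 0
-- (σᵢ = 0 for i > n and σ_∞ = 0).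

IsPartition : List ℕ → Set
IsPartition σ = All (0 <_) σ × Linked _≥_ σ

lookupD : List ℕ → ℕ → ℕ
lookupD []       _       = 0
lookupD (x ∷ xs) zero    = x
lookupD (x ∷ xs) (suc i) = lookupD xs i

-- σ_i for an index i ∈ [1,∞]   (value at fin 0 is irrelevant)
val : List ℕ → Ext → ℕ
val σ (fin zero)    = 0
val σ (fin (suc i)) = lookupD σ i
val σ ∞             = 0

maxPart : List ℕ → ℕ
maxPart = foldr _⊔_ 0

InP : ℕ → ℕ → List ℕ → Set
InP h k σ = IsPartition σ × length σ ≤ h × maxPart σ ≡ k

pInterval : List ℕ → ℕ → Ext → Set
pInterval σ p i = ValidIdx i × val σ i ≡ p

[_,_] : Ext → Ext → Ext → Set
[ a , b ] i = ValidIdx i × a ≤ᵉ i × i ≤ᵉ b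

-- elements (p , I) of a profile, with I = [a , b] given by endpoints
Triple : Set
Triple = ℕ × Ext × Ext

profile : List (List ℕ) → Triple → Set
profile P (p , a , b) =
  ValidIdx a × a ≤ᵉ b
  × (∃ λ σ → σ ∈ P × (pInterval σ p ≐ [ a , b ]))
  × (∀ τ → τ ∈ P → [ a , b ] ⊆ₛ pInterval τ p → pInterval τ p ⊆ₛ [ a , b ])

IsStaircase : Ext → ℕ → (Triple → Set) → Set
IsStaircase ℓ k S =
  Σ ℕ λ s → Σ (ℕ → ℕ) λ p → Σ (ℕ → Ext) λ a → Σ (ℕ → Ext) λ b →
    (S ≐ (λ t → Σ ℕ λ i → 1 ≤ i × i ≤ suc s × t ≡ (p i , a i , b i)))
    × p 1 ≡ k
    × (∀ i → 1 ≤ i → i ≤ s → p (suc i) < p i)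
    × p (suc s) ≡ 0
    × a 1 ≡ fin 1
    × (1 ≤ s → a 2 ≢ fin 1)
    × (∀ i → 1 ≤ i → i ≤ suc s → a i ≤ᵉ b i)
    × b (suc s) ≡ ∞
    × (∀ i → 1 ≤ i → i ≤ s → (a (suc i) ≡ b i ⊎ a (suc i) ≡ sucᵉ (b i)))
    × ℓ ≡ b s

IsStaircaseAny : (Triple → Set) → Set
IsStaircaseAny S = Σ Ext λ ℓ → Σ ℕ λ k → 0 < k × IsStaircase ℓ k S

InSS : ℕ → ℕ → (Triple → Set) → Set
InSS h k S = Σ Ext λ ℓ → IsStaircase ℓ k S × ℓ ≤ᵉ fin h

module Submission where

-- Given an (ℓ,k)-staircase with stairs (p i , [a i , b i]),
-- 1 ≤ i ≤ s+1, and ℓ = b s ≤ h, every index J ≥ 1 has a home stair: the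
-- first one whose end reaches J, which then contains J.  The partition σ i
-- takes the height p i on stair i and the height of the home stair at all
-- other indices.  It is weakly decreasing (stairs move right and step
-- down), has at most h parts (stairs before the last end by h), has largest
-- part p 1 = k (only stair 1 contains index 1), and all its level sets at
-- stair heights lie inside the stairs, its p i-level set being exactly
-- [a i , b i].  Hence the profile of {σ 1, …, σ (s+1)} is the staircase.
--
-- Conversely, if the profile of a family in 𝒫(h,k) is an
-- (ℓ,k′)-staircase, then the top stair forces k′ = k, and the last finite
-- stair, having positive height, ends at a positive part, so ℓ ≤ h.

open import Defs
open import Data.Nat using (ℕ; zero; suc; _<_; _≤_; z≤n; s≤s; s≤s⁻¹; _≤?_; _<?_; _≥_)
open import Data.Nat.Properties
open import Data.List using (List; []; _∷_; length; applyUpTo)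
open import Data.List.Properties using (length-applyUpTo)
open import Data.List.Relation.Unary.All using (All; lookup)
import Data.List.Relation.Unary.All.Properties as All
open import Data.List.Relation.Unary.Linked using (Linked; _∷_)
import Data.List.Relation.Unary.Linked.Properties as Linked
open import Data.List.Membership.Propositional using (_∈_)
open import Data.List.Membership.Propositional.Properties using (∈-applyUpTo⁺; ∈-applyUpTo⁻)
open import Data.Product using (Σ; _×_; _,_; proj₁; proj₂)
open import Data.Sum using (_⊎_; inj₁; inj₂)
open import Function using (_∘_)
open import Relation.Nullary using (¬_; Dec; yes; no; contradiction)
open import Relation.Nullary.Decidable using (_×-dec_)
open import Relation.Unary using (Decidable)
open import Relation.Binary.PropositionalEquality hiding ([_])
open import Relation.Binary.Definitions using (tri<; tri≈; tri>)

≤ᵉ-refl : ∀ x → x ≤ᵉ x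
≤ᵉ-refl (fin n) = fin≤fin ≤-refl
≤ᵉ-refl ∞       = ∞ ≤∞

≤ᵉ-reflexive : ∀ {x y} → x ≡ y → x ≤ᵉ y
≤ᵉ-reflexive {x} refl = ≤ᵉ-refl x

≤ᵉ-trans : ∀ {x y z} → x ≤ᵉ y → y ≤ᵉ z → x ≤ᵉ z
≤ᵉ-trans _           (_ ≤∞)      = _ ≤∞
≤ᵉ-trans (fin≤fin p) (fin≤fin q) = fin≤fin (≤-trans p q)

≤ᵉ-antisym : ∀ {x y} → x ≤ᵉ y → y ≤ᵉ x → x ≡ y
≤ᵉ-antisym (fin≤fin p) (fin≤fin q) = cong fin (≤-antisym p q)
≤ᵉ-antisym (_ ≤∞)      (_ ≤∞)      = refl

_≤ᵉ?_ : ∀ x y → Dec (x ≤ᵉ y)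
fin m ≤ᵉ? fin n with m ≤? n
... | yes m≤n = yes (fin≤fin m≤n)
... | no  m≰n = no λ { (fin≤fin m≤n) → m≰n m≤n }
x     ≤ᵉ? ∞     = yes (x ≤∞)
∞     ≤ᵉ? fin n = no λ ()

fin-≤ᵉ⁻ : ∀ {m n} → fin m ≤ᵉ fin n → m ≤ n
fin-≤ᵉ⁻ (fin≤fin m≤n) = m≤n

≤ᵉ-sucᵉ : ∀ x → x ≤ᵉ sucᵉ x
≤ᵉ-sucᵉ (fin n) = fin≤fin (n≤1+n n)
≤ᵉ-sucᵉ ∞       = ∞ ≤∞

≰ᵉ⇒sucᵉ≤ᵉ : ∀ {n y} → ¬ (fin n ≤ᵉ y) → sucᵉ y ≤ᵉ fin n
≰ᵉ⇒sucᵉ≤ᵉ {n} {fin m} n≰m = fin≤fin (≰⇒> (n≰m ∘ fin≤fin))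
≰ᵉ⇒sucᵉ≤ᵉ {n} {∞}     n≰∞ = contradiction (fin n ≤∞) n≰∞

valid⇒1≤ᵉ : ∀ {x} → ValidIdx x → fin 1 ≤ᵉ x
valid⇒1≤ᵉ (fin-valid n) = fin≤fin (s≤s z≤n)
valid⇒1≤ᵉ ∞-valid       = fin 1 ≤∞

1≤ᵉ⇒valid : ∀ {x} → fin 1 ≤ᵉ x → ValidIdx x
1≤ᵉ⇒valid {fin zero}    (fin≤fin ())
1≤ᵉ⇒valid {fin (suc n)} _ = fin-valid n
1≤ᵉ⇒valid {∞}           _ = ∞-valid

valid-mono : ∀ {x y} → ValidIdx x → x ≤ᵉ y → ValidIdx y
valid-mono vx x≤y = 1≤ᵉ⇒valid (≤ᵉ-trans (valid⇒1≤ᵉ vx) x≤y)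

[,]-⊆-bounds : ∀ {x y x′ y′} → ValidIdx x → x ≤ᵉ y →
               [ x , y ] ⊆ₛ [ x′ , y′ ] → x′ ≤ᵉ x × y ≤ᵉ y′
[,]-⊆-bounds {x} {y} vx x≤y sub =
  proj₁ (proj₂ (sub x (vx , ≤ᵉ-refl x , x≤y))) ,
  proj₂ (proj₂ (sub y (valid-mono vx x≤y , x≤y , ≤ᵉ-refl y)))

[,]-injective : ∀ {x y x′ y′} → ValidIdx x → x ≤ᵉ y → ValidIdx x′ → x′ ≤ᵉ y′ →
                [ x , y ] ≐ [ x′ , y′ ] → x ≡ x′ × y ≡ y′
[,]-injective vx x≤y vx′ x′≤y′ (sub , sup)
  with [,]-⊆-bounds vx x≤y sub | [,]-⊆-bounds vx′ x′≤y′ sup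
... | x′≤x , y≤y′ | x≤x′ , y′≤y = ≤ᵉ-antisym x≤x′ x′≤x , ≤ᵉ-antisym y≤y′ y′≤y

≐-sym : {A : Set} {X Y : A → Set} → X ≐ Y → Y ≐ X
≐-sym (X⊆Y , Y⊆X) = Y⊆X , X⊆Y

≐-trans : {A : Set} {X Y Z : A → Set} → X ≐ Y → Y ≐ Z → X ≐ Z
≐-trans (X⊆Y , Y⊆X) (Y⊆Z , Z⊆Y) = (λ t → Y⊆Z t ∘ X⊆Y t) , (λ t → Y⊆X t ∘ Z⊆Y t)

staircase-resp : ∀ {ℓ k S T} → S ≐ T → IsStaircase ℓ k S → IsStaircase ℓ k T
staircase-resp S≐T (s , p , a , b , S≐list , rest) = s , p , a , b , ≐-trans (≐-sym S≐T) S≐list , rest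

Least : (ℕ → Set) → ℕ → Set
Least Q m = Q m × (∀ m′ → m′ < m → ¬ Q m′)

module _ {Q : ℕ → Set} (Q? : Decidable Q) where

  least-upTo : ∀ n → (Σ ℕ λ m → m ≤ n × Least Q m) ⊎ (∀ m → m ≤ n → ¬ Q m)
  least-upTo zero with Q? 0
  ... | yes q0 = inj₁ (0 , z≤n , q0 , λ _ ())
  ... | no ¬q0 = inj₂ λ { .0 z≤n → ¬q0 }
  least-upTo (suc n) with least-upTo n
  ... | inj₁ (m , m≤n , least) = inj₁ (m , m≤n⇒m≤1+n m≤n , least)
  ... | inj₂ none with Q? (suc n)
  ...   | yes q = inj₁ (suc n , ≤-refl , q , λ m′ m′<1+n → none m′ (s≤s⁻¹ m′<1+n))
  ...   | no ¬q = inj₂ λ m m≤1+n → case-≤ m m≤1+n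
    where
    case-≤ : ∀ m → m ≤ suc n → ¬ Q m
    case-≤ m m≤1+n with m≤n⇒m<n∨m≡n m≤1+n
    ... | inj₁ m<1+n = none m (s≤s⁻¹ m<1+n)
    ... | inj₂ refl  = ¬q

  least : ∀ n → Q n → Σ ℕ λ m → m ≤ n × Least Q m
  least n qn with least-upTo n
  ... | inj₁ found = found
  ... | inj₂ none  = contradiction qn (none n ≤-refl)

chain : {A : Set} (R : A → A → Set) → (∀ {x} → R x x) → (∀ {x y z} → R x y → R y z → R x z) →
        (f : ℕ → A) {lo hi : ℕ} → (∀ i → lo ≤ i → i < hi → R (f i) (f (suc i))) →
        ∀ {m n} → lo ≤ m → m ≤ n → n ≤ hi → R (f m) (f n)
chain R refl′ trans′ f step {n = zero}  lo≤m z≤n   n≤hi = refl′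
chain R refl′ trans′ f step {n = suc n} lo≤m m≤1+n n<hi with m≤n⇒m<n∨m≡n m≤1+n
... | inj₂ refl  = refl′
... | inj₁ m<1+n = trans′ (chain R refl′ trans′ f step lo≤m (s≤s⁻¹ m<1+n) (<⇒≤ n<hi))
                          (step n (≤-trans lo≤m (s≤s⁻¹ m<1+n)) n<hi)

Antitone : (ℕ → ℕ) → Set
Antitone g = ∀ j → g (suc j) ≤ g j

antitone-≤ : ∀ {g} → Antitone g → ∀ {m n} → m ≤ n → g n ≤ g m
antitone-≤ {g} anti m≤n = chain (λ x y → y ≤ x) ≤-refl (λ x≥y y≥z → ≤-trans y≥z x≥y) g
                            (λ i _ _ → anti i) z≤n m≤n ≤-refl

positiveRun : ℕ → (ℕ → ℕ) → ℕ
positiveRun zero    g = 0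
positiveRun (suc n) g with g 0
... | zero  = 0
... | suc _ = suc (positiveRun n (g ∘ suc))

partitionOf : ℕ → (ℕ → ℕ) → List ℕ
partitionOf n g = applyUpTo g (positiveRun n g)

positiveRun-≤ : ∀ n g → positiveRun n g ≤ n
positiveRun-≤ zero    g = z≤n
positiveRun-≤ (suc n) g with g 0
... | zero  = z≤n
... | suc _ = s≤s (positiveRun-≤ n (g ∘ suc))

positiveRun-positive : ∀ n g {i} → i < positiveRun n g → 0 < g i
positiveRun-positive (suc n) g {i} i<run with g 0 in g0≡
positiveRun-positive (suc n) g {zero}  i<run | suc _ = subst (0 <_) (sym g0≡) (s≤s z≤n)
positiveRun-positive (suc n) g {suc i} i<run | suc _ = positiveRun-positive n (g ∘ suc) (s≤s⁻¹ i<run)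

positiveRun-vanishes : ∀ n g → Antitone g → (∀ j → n ≤ j → g j ≡ 0) →
                       ∀ j → positiveRun n g ≤ j → g j ≡ 0
positiveRun-vanishes zero    g anti vanish j _ = vanish j z≤n
positiveRun-vanishes (suc n) g anti vanish j run≤j with g 0 in g0≡
... | zero = n≤0⇒n≡0 (subst (g j ≤_) g0≡ (antitone-≤ anti z≤n))
positiveRun-vanishes (suc n) g anti vanish (suc j) (s≤s run≤j) | suc _ =
  positiveRun-vanishes n (g ∘ suc) (anti ∘ suc) (λ j n≤j → vanish (suc j) (s≤s n≤j)) j run≤j

lookupD-applyUpTo : ∀ g m {j} → j < m → lookupD (applyUpTo g m) j ≡ g j
lookupD-applyUpTo g (suc m) {zero}  _   = refl
lookupD-applyUpTo g (suc m) {suc j} j<m = lookupD-applyUpTo (g ∘ suc) m (s≤s⁻¹ j<m)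

lookupD-beyond : ∀ xs {j} → length xs ≤ j → lookupD xs j ≡ 0
lookupD-beyond []       _               = refl
lookupD-beyond (x ∷ xs) {suc j} (s≤s l) = lookupD-beyond xs l

partitionOf-isPartition : ∀ n {g} → Antitone g → IsPartition (partitionOf n g)
partitionOf-isPartition n {g} anti =
  All.applyUpTo⁺₁ g (positiveRun n g) (positiveRun-positive n g) ,
  Linked.applyUpTo⁺₂ g (positiveRun n g) anti

partitionOf-length : ∀ n g → length (partitionOf n g) ≤ n
partitionOf-length n g = subst (_≤ n) (sym (length-applyUpTo g (positiveRun n g))) (positiveRun-≤ n g)

partitionOf-parts : ∀ n {g} → Antitone g → (∀ j → n ≤ j → g j ≡ 0) →
                    ∀ j → lookupD (partitionOf n g) j ≡ g j
partitionOf-parts n {g} anti vanish j with j <? positiveRun n g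
... | yes j<run = lookupD-applyUpTo g _ j<run
... | no  j≮run = begin
  lookupD (partitionOf n g) j ≡⟨ lookupD-beyond (partitionOf n g) length≤j ⟩
  0                           ≡⟨ sym (positiveRun-vanishes n g anti vanish j (≮⇒≥ j≮run)) ⟩
  g j                         ∎
  where
  open ≡-Reasoning
  length≤j = subst (_≤ j) (sym (length-applyUpTo g (positiveRun n g))) (≮⇒≥ j≮run)

maxPart-≤-head : ∀ x xs → Linked _≥_ (x ∷ xs) → maxPart xs ≤ x
maxPart-≤-head x []       _           = z≤n
maxPart-≤-head x (y ∷ ys) (y≤x ∷ lnk) = ⊔-lub y≤x (≤-trans (maxPart-≤-head y ys lnk) y≤x)

maxPart-head : ∀ σ → Linked _≥_ σ → maxPart σ ≡ lookupD σ 0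
maxPart-head []       _   = refl
maxPart-head (x ∷ xs) lnk = m≥n⇒m⊔n≡m (maxPart-≤-head x xs lnk)

positive⇒≤length : ∀ σ {x} → ValidIdx x → 0 < val σ x → x ≤ᵉ fin (length σ)
positive⇒≤length σ (fin-valid i) pos =
  fin≤fin (≰⇒> λ len≤i → <-irrefl (sym (lookupD-beyond σ len≤i)) pos)
positive⇒≤length σ ∞-valid ()

profile-witness : ∀ {P p x y} → profile P (p , x , y) →
                  Σ (List ℕ) λ σ → σ ∈ P × (∀ e → [ x , y ] e → val σ e ≡ p)
profile-witness (_ , _ , (σ , σ∈P , _ , [x,y]⊆I) , _) = σ , σ∈P , λ e e∈ → proj₂ ([x,y]⊆I e e∈)

record Stairs (s : ℕ) (p : ℕ → ℕ) (a b : ℕ → Ext) : Set where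
  field
    p-step   : ∀ i → 1 ≤ i → i ≤ s → p (suc i) < p i
    p-last   : p (suc s) ≡ 0
    a-first  : a 1 ≡ fin 1
    a-second : 1 ≤ s → a 2 ≢ fin 1
    a≤b      : ∀ i → 1 ≤ i → i ≤ suc s → a i ≤ᵉ b i
    b-last   : b (suc s) ≡ ∞
    adjacent : ∀ i → 1 ≤ i → i ≤ s → a (suc i) ≡ b i ⊎ a (suc i) ≡ sucᵉ (b i)

module StairGeometry {s : ℕ} {p : ℕ → ℕ} {a b : ℕ → Ext} (st : Stairs s p a b) where
  open Stairs st

  IsStair : ℕ → Set
  IsStair i = 1 ≤ i × i ≤ suc s

  last-stair : IsStair (suc s)
  last-stair = s≤s z≤n , ≤-refl

  OnStair : ℕ → ℕ → Set
  OnStair i J = a i ≤ᵉ fin J × fin J ≤ᵉ b i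

  onStair? : ∀ i J → Dec (OnStair i J)
  onStair? i J = (a i ≤ᵉ? fin J) ×-dec (fin J ≤ᵉ? b i)

  b≤a-next : ∀ i → 1 ≤ i → i ≤ s → b i ≤ᵉ a (suc i)
  b≤a-next i 1≤i i≤s with adjacent i 1≤i i≤s
  ... | inj₁ a≡b  = ≤ᵉ-reflexive (sym a≡b)
  ... | inj₂ a≡b+ = subst (b i ≤ᵉ_) (sym a≡b+) (≤ᵉ-sucᵉ (b i))

  a-next≤sucᵉ-b : ∀ i → 1 ≤ i → i ≤ s → a (suc i) ≤ᵉ sucᵉ (b i)
  a-next≤sucᵉ-b i 1≤i i≤s with adjacent i 1≤i i≤s
  ... | inj₁ a≡b  = subst (_≤ᵉ sucᵉ (b i)) (sym a≡b) (≤ᵉ-sucᵉ (b i))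
  ... | inj₂ a≡b+ = ≤ᵉ-reflexive a≡b+

  a-mono : ∀ {m n} → 1 ≤ m → m ≤ n → n ≤ suc s → a m ≤ᵉ a n
  a-mono = chain _≤ᵉ_ (≤ᵉ-refl _) ≤ᵉ-trans a
             (λ i 1≤i i<1+s → ≤ᵉ-trans (a≤b i 1≤i (<⇒≤ i<1+s)) (b≤a-next i 1≤i (s≤s⁻¹ i<1+s)))

  b-mono : ∀ {m n} → 1 ≤ m → m ≤ n → n ≤ suc s → b m ≤ᵉ b n
  b-mono = chain _≤ᵉ_ (≤ᵉ-refl _) ≤ᵉ-trans b
             (λ i 1≤i i<1+s → ≤ᵉ-trans (b≤a-next i 1≤i (s≤s⁻¹ i<1+s)) (a≤b (suc i) (s≤s z≤n) i<1+s))

  p-antitone : ∀ {m n} → 1 ≤ m → m ≤ n → n ≤ suc s → p n ≤ p m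
  p-antitone = chain (λ x y → y ≤ x) ≤-refl (λ x≥y y≥z → ≤-trans y≥z x≥y) p
                 (λ i 1≤i i<1+s → <⇒≤ (p-step i 1≤i (s≤s⁻¹ i<1+s)))

  p-strict : ∀ {m n} → 1 ≤ m → m < n → n ≤ suc s → p n < p m
  p-strict 1≤m m<n n≤1+s =
    ≤-<-trans (p-antitone (s≤s z≤n) m<n n≤1+s) (p-step _ 1≤m (s≤s⁻¹ (≤-trans m<n n≤1+s)))

  p-injective : ∀ {m n} → IsStair m → IsStair n → p m ≡ p n → m ≡ n
  p-injective {m} {n} (1≤m , m≤1+s) (1≤n , n≤1+s) pm≡pn with <-cmp m n
  ... | tri< m<n _ _ = contradiction (sym pm≡pn) (<⇒≢ (p-strict 1≤m m<n n≤1+s))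
  ... | tri≈ _ m≡n _ = m≡n
  ... | tri> _ _ n<m = contradiction pm≡pn (<⇒≢ (p-strict 1≤n n<m m≤1+s))

  a-valid : ∀ {i} → IsStair i → ValidIdx (a i)
  a-valid {i} (1≤i , i≤1+s) = 1≤ᵉ⇒valid (subst (_≤ᵉ a i) a-first (a-mono ≤-refl 1≤i i≤1+s))

  -- Index 1 lies only on the first stair (this is where a 2 ≠ 1 is used).
  a≤1⇒first : ∀ {i} → IsStair i → a i ≤ᵉ fin 1 → i ≡ 1
  a≤1⇒first {suc zero}    _                     _    = refl
  a≤1⇒first {suc (suc i)} (_ , s≤s 2+i≤1+s) a≤1 = contradiction a₂≡1 (a-second 1≤s)
    where
    1≤s = ≤-trans (s≤s z≤n) 2+i≤1+s
    a₂≡1 : a 2 ≡ fin 1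
    a₂≡1 = ≤ᵉ-antisym (≤ᵉ-trans (a-mono (s≤s z≤n) (s≤s (s≤s z≤n)) (s≤s 2+i≤1+s)) a≤1)
                      (subst (_≤ᵉ a 2) a-first (≤ᵉ-trans (a≤b 1 ≤-refl (s≤s z≤n)) (b≤a-next 1 ≤-refl 1≤s)))

  -- An index above the end of every earlier stair is beyond the start of
  -- stair m, because consecutive stairs leave no gap.
  above-previous⇒a≤ : ∀ {J m} → 1 ≤ J → IsStair m →
                      (∀ m′ → 1 ≤ m′ → m′ < m → ¬ fin J ≤ᵉ b m′) → a m ≤ᵉ fin J
  above-previous⇒a≤ {m = suc zero}    1≤J _ _ = subst (_≤ᵉ _) (sym a-first) (fin≤fin 1≤J)
  above-previous⇒a≤ {m = suc (suc m)} 1≤J (_ , s≤s 2+m≤1+s) above =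
    ≤ᵉ-trans (a-next≤sucᵉ-b (suc m) (s≤s z≤n) 2+m≤1+s)
             (≰ᵉ⇒sucᵉ≤ᵉ (above (suc m) (s≤s z≤n) ≤-refl))

  -- The home of J is the first stair whose end reaches J; it exists since
  -- the last stair ends at ∞.
  Reaches : ℕ → ℕ → Set
  Reaches J m = 1 ≤ m × fin J ≤ᵉ b m

  home-search : ∀ J → Σ ℕ λ m → m ≤ suc s × Least (Reaches J) m
  home-search J = least (λ m → (1 ≤? m) ×-dec (fin J ≤ᵉ? b m)) (suc s)
                        (s≤s z≤n , subst (fin J ≤ᵉ_) (sym b-last) (fin J ≤∞))

  home : ℕ → ℕ
  home J = proj₁ (home-search J)

  home-stair : ∀ J → IsStair (home J)
  home-stair J with home-search J
  ... | _ , m≤1+s , (1≤m , _) , _ = 1≤m , m≤1+s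

  home-reaches : ∀ J → fin J ≤ᵉ b (home J)
  home-reaches J with home-search J
  ... | _ , _ , (_ , J≤b) , _ = J≤b

  home-minimal : ∀ {J m} → 1 ≤ m → fin J ≤ᵉ b m → home J ≤ m
  home-minimal {J} 1≤m J≤b with home-search J
  ... | _ , _ , _ , below = ≮⇒≥ λ m<home → below _ m<home (1≤m , J≤b)

  home-onStair : ∀ {J} → 1 ≤ J → OnStair (home J) J
  home-onStair {J} 1≤J with home-search J
  ... | m , m≤1+s , (1≤m , J≤b) , below =
    above-previous⇒a≤ 1≤J (1≤m , m≤1+s) (λ m′ 1≤m′ m′<m J≤b′ → below m′ m′<m (1≤m′ , J≤b′)) , J≤b

  choice : ℕ → ℕ → ℕ
  choice i J with onStair? i J
  ... | yes _ = i
  ... | no  _ = home J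

  choice-stair : ∀ {i} J → IsStair i → IsStair (choice i J)
  choice-stair {i} J i-stair with onStair? i J
  ... | yes _ = i-stair
  ... | no  _ = home-stair J

  choice-onStair : ∀ i {J} → 1 ≤ J → OnStair (choice i J) J
  choice-onStair i {J} 1≤J with onStair? i J
  ... | yes J-on-i = J-on-i
  ... | no  _      = home-onStair 1≤J

  choice-self : ∀ {i J} → OnStair i J → choice i J ≡ i
  choice-self {i} {J} J-on-i with onStair? i J
  ... | yes _   = refl
  ... | no  ¬on = contradiction J-on-i ¬on

  choice-mono : ∀ {i J J′} → IsStair i → J ≤ J′ → choice i J ≤ choice i J′
  choice-mono {i} {J} {J′} (1≤i , i≤1+s) J≤J′ with onStair? i J | onStair? i J′
  ... | yes _ | yes _ = ≤-refl
  ... | no  _ | yes (_ , J′≤b) = home-minimal 1≤i (≤ᵉ-trans (fin≤fin J≤J′) J′≤b)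
  ... | no  _ | no  _ = home-minimal (proj₁ (home-stair J′)) (≤ᵉ-trans (fin≤fin J≤J′) (home-reaches J′))
  ... | yes (a≤J , _) | no ¬on = ≮⇒≥ λ home<i →
        ¬on (≤ᵉ-trans a≤J (fin≤fin J≤J′) ,
             ≤ᵉ-trans (home-reaches J′) (b-mono (proj₁ (home-stair J′)) (<⇒≤ home<i) i≤1+s))

  choice-first : ∀ {i} → IsStair i → choice i 1 ≡ 1
  choice-first {i} i-stair =
    a≤1⇒first (choice-stair 1 i-stair) (proj₁ (choice-onStair i ≤-refl))

module Realisation {h s : ℕ} {p : ℕ → ℕ} {a b : ℕ → Ext} (st : Stairs s p a b)
                   (b-bounded : ∀ m → 1 ≤ m → m ≤ s → b m ≤ᵉ fin h) where
  open Stairs st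
  open StairGeometry st

  beyond-h⇒last : ∀ {m J} → IsStair m → fin J ≤ᵉ b m → h < J → m ≡ suc s
  beyond-h⇒last {m} (1≤m , m≤1+s) J≤b h<J with m ≤? s
  ... | yes m≤s = contradiction (fin-≤ᵉ⁻ (≤ᵉ-trans J≤b (b-bounded m 1≤m m≤s))) (<⇒≱ h<J)
  ... | no  m≰s = ≤-antisym m≤1+s (≰⇒> m≰s)

  -- The parts of σ i: the part at index j + 1.
  parts : ℕ → ℕ → ℕ
  parts i j = p (choice i (suc j))

  -- The parts decrease because the chosen stairs move right, and vanish
  -- from index h + 1 on, where only the last stair (of height 0) reaches.
  parts-antitone : ∀ {i} → IsStair i → Antitone (parts i)
  parts-antitone i-stair j =
    p-antitone (proj₁ (choice-stair (suc j) i-stair)) (choice-mono i-stair (n≤1+n (suc j)))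
               (proj₂ (choice-stair (suc (suc j)) i-stair))

  parts-vanish : ∀ {i} → IsStair i → ∀ j → h ≤ j → parts i j ≡ 0
  parts-vanish {i} i-stair j h≤j =
    trans (cong p (beyond-h⇒last (choice-stair (suc j) i-stair) (proj₂ (choice-onStair i (s≤s z≤n))) (s≤s h≤j)))
          p-last

  σ : ℕ → List ℕ
  σ i = partitionOf h (parts i)

  σ-part : ∀ {i} → IsStair i → ∀ j → val (σ i) (fin (suc j)) ≡ p (choice i (suc j))
  σ-part i-stair = partitionOf-parts h (parts-antitone i-stair) (parts-vanish i-stair)

  σ-InP : ∀ {i} → IsStair i → InP h (p 1) (σ i)
  σ-InP {i} i-stair = isPartition , partitionOf-length h (parts i) , largest
    where
    isPartition = partitionOf-isPartition h (parts-antitone i-stair)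
    largest : maxPart (σ i) ≡ p 1
    largest = begin
      maxPart (σ i)        ≡⟨ maxPart-head (σ i) (proj₂ isPartition) ⟩
      val (σ i) (fin 1)    ≡⟨ σ-part i-stair 0 ⟩
      p (choice i 1)       ≡⟨ cong p (choice-first i-stair) ⟩
      p 1                  ∎
      where open ≡-Reasoning

  σ-value : ∀ {i} → IsStair i → ∀ e → ValidIdx e →
            Σ ℕ λ m → IsStair m × val (σ i) e ≡ p m × [ a m , b m ] e
  σ-value {i} i-stair (fin (suc j)) v =
    choice i (suc j) , choice-stair (suc j) i-stair , σ-part i-stair j , v , choice-onStair i (s≤s z≤n)
  σ-value i-stair ∞ _ =
    suc s , last-stair , sym p-last , ∞-valid , a (suc s) ≤∞ , subst (∞ ≤ᵉ_) (sym b-last) (∞ ≤∞)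

  σ-own : ∀ {i} → IsStair i → ∀ e → [ a i , b i ] e → val (σ i) e ≡ p i
  σ-own i-stair (fin (suc j)) (_ , a≤e , e≤b) = trans (σ-part i-stair j) (cong p (choice-self (a≤e , e≤b)))
  σ-own {i} (1≤i , i≤1+s) ∞ (_ , _ , ∞≤b) with i ≤? s
  ... | yes i≤s = contradiction (≤ᵉ-trans ∞≤b (b-bounded i 1≤i i≤s)) λ ()
  ... | no  i≰s = trans (sym p-last) (cong p (≤-antisym (≰⇒> i≰s) i≤1+s))

  σ-level⊆stair : ∀ {i m} → IsStair i → IsStair m → pInterval (σ i) (p m) ⊆ₛ [ a m , b m ]
  σ-level⊆stair i-stair m-stair e (ve , σe≡pm) with σ-value i-stair e ve
  ... | m′ , m′-stair , σe≡pm′ , e∈stair =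
    subst (λ t → [ a t , b t ] e) (p-injective m′-stair m-stair (trans (sym σe≡pm′) σe≡pm)) e∈stair

  σ-level-own : ∀ {i} → IsStair i → pInterval (σ i) (p i) ≐ [ a i , b i ]
  σ-level-own i-stair = σ-level⊆stair i-stair i-stair , λ e e∈ → proj₁ e∈ , σ-own i-stair e e∈

  family : List (List ℕ)
  family = applyUpTo (σ ∘ suc) (suc s)

  family-member : ∀ {τ} → τ ∈ family → Σ ℕ λ i → IsStair i × τ ≡ σ i
  family-member τ∈ with ∈-applyUpTo⁻ (σ ∘ suc) τ∈
  ... | j , j<1+s , τ≡ = suc j , (s≤s z≤n , j<1+s) , τ≡

  σ∈family : ∀ {i} → IsStair i → σ i ∈ family
  σ∈family {suc j} (_ , 1+j≤1+s) = ∈-applyUpTo⁺ (σ ∘ suc) 1+j≤1+s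

  family-InP : All (InP h (p 1)) family
  family-InP = All.applyUpTo⁺₁ (σ ∘ suc) (suc s) (λ j<1+s → σ-InP (s≤s z≤n , j<1+s))

  StairSet : Triple → Set
  StairSet t = Σ ℕ λ i → 1 ≤ i × i ≤ suc s × t ≡ (p i , a i , b i)

  -- Each stair is the p i-interval of σ i, and maximal because every
  -- p i-level set in the family lies inside stair i.
  stairs⊆profile : StairSet ⊆ₛ profile family
  stairs⊆profile _ (i , 1≤i , i≤1+s , refl) =
    a-valid (1≤i , i≤1+s) , a≤b i 1≤i i≤1+s , (σ i , σ∈family (1≤i , i≤1+s) , σ-level-own (1≤i , i≤1+s)) ,
    maximal
    where
    maximal : ∀ τ → τ ∈ family → [ a i , b i ] ⊆ₛ pInterval τ (p i) → pInterval τ (p i) ⊆ₛ [ a i , b i ]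
    maximal τ τ∈ _ with family-member τ∈
    ... | j , j-stair , refl = σ-level⊆stair j-stair (1≤i , i≤1+s)

  -- A profile member (q , [x,y]) is a level set of some σ i; its height is
  -- that of the stair m containing x, so [x,y] lies inside stair m, and
  -- maximality against σ m gives the reverse inclusion.
  profile⊆stairs : profile family ⊆ₛ StairSet
  profile⊆stairs (q , x , y) (vx , x≤y , (τ , τ∈ , τ-level) , maximal) with family-member τ∈
  ... | i , i-stair , refl with σ-value i-stair x vx
  ... | m , (1≤m , m≤1+s) , σx≡pm , _ =
    m , 1≤m , m≤1+s , cong₂ _,_ q≡pm (cong₂ _,_ (proj₁ ends) (proj₂ ends))
    where
    m-stair = 1≤m , m≤1+s
    q≡pm : q ≡ p m
    q≡pm = trans (sym (proj₂ (proj₂ τ-level x (vx , ≤ᵉ-refl x , x≤y)))) σx≡pm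
    [x,y]⊆stair : [ x , y ] ⊆ₛ [ a m , b m ]
    [x,y]⊆stair e e∈ = σ-level⊆stair i-stair m-stair e (subst (λ t → pInterval (σ i) t e) q≡pm (proj₂ τ-level e e∈))
    stair⊆level : [ a m , b m ] ⊆ₛ pInterval (σ m) q
    stair⊆level e e∈ = subst (λ t → pInterval (σ m) t e) (sym q≡pm) (proj₂ (σ-level-own m-stair) e e∈)
    stair⊆[x,y] : [ a m , b m ] ⊆ₛ [ x , y ]
    stair⊆[x,y] e e∈ =
      maximal (σ m) (σ∈family m-stair) (λ e′ → stair⊆level e′ ∘ [x,y]⊆stair e′) e (stair⊆level e e∈)
    ends = [,]-injective vx x≤y (a-valid m-stair) (a≤b m 1≤m m≤1+s) ([x,y]⊆stair , stair⊆[x,y])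

  profile-family : StairSet ≐ profile family
  profile-family = stairs⊆profile , profile⊆stairs

staircase-realisable : ∀ {h ℓ k S} → IsStaircase ℓ k S → ℓ ≤ᵉ fin h →
                       Σ (List (List ℕ)) λ P → P ≢ [] × All (InP h k) P × S ≐ profile P
staircase-realisable {h}
  (s , p , a , b , S≐stairs , p₁≡k , p-step , p-last , a-first , a-second , a≤b , b-last , adjacent , ℓ≡bₛ) ℓ≤h =
  family , (λ ()) , subst (λ k → All (InP h k) family) p₁≡k family-InP , ≐-trans S≐stairs profile-family
  where
  st : Stairs s p a b
  st = record { p-step = p-step ; p-last = p-last ; a-first = a-first ; a-second = a-second
              ; a≤b = a≤b ; b-last = b-last ; adjacent = adjacent }
  b-bounded : ∀ m → 1 ≤ m → m ≤ s → b m ≤ᵉ fin h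
  b-bounded m 1≤m m≤s = ≤ᵉ-trans (StairGeometry.b-mono st 1≤m m≤s (n≤1+n s)) (subst (_≤ᵉ fin h) ℓ≡bₛ ℓ≤h)
  open Realisation st b-bounded

-- Conversely, if the profile of a family in 𝒫(h,k) is an (ℓ,k′)-staircase
-- with k′ > 0, then k′ = k (the top stair contains index 1, where every
-- partition has its largest part) and ℓ ≤ h (the last finite stair has
-- positive height, so its end is a positive part of some member).
profile-staircase-bounds : ∀ {h k P ℓ k′} → All (InP h k) P → 0 < k′ → IsStaircase ℓ k′ (profile P) →
                           k′ ≡ k × ℓ ≤ᵉ fin h
profile-staircase-bounds {h} {k} {P} {ℓ} {k′} P⊆𝒫 0<k′
  (s , p , a , b , profile≐stairs , p₁≡k′ , p-step , p-last , a-first , _ , a≤b , _ , _ , ℓ≡bₛ) =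
  top-height , length-bound
  where
  stair∈profile : ∀ {i} → 1 ≤ i → i ≤ suc s → profile P (p i , a i , b i)
  stair∈profile {i} 1≤i i≤1+s = proj₂ profile≐stairs _ (i , 1≤i , i≤1+s , refl)

  top-height : k′ ≡ k
  top-height with profile-witness (stair∈profile ≤-refl (s≤s z≤n))
  ... | σ , σ∈P , constant with lookup P⊆𝒫 σ∈P
  ... | (_ , decreasing) , _ , maxσ≡k = begin
    k′                  ≡⟨ sym p₁≡k′ ⟩
    p 1                 ≡⟨ sym (constant (fin 1) (fin-valid 0 , ≤ᵉ-reflexive a-first , 1≤b₁)) ⟩
    val σ (fin 1)       ≡⟨ sym (maxPart-head σ decreasing) ⟩
    maxPart σ           ≡⟨ maxσ≡k ⟩
    k                   ∎
    where
    open ≡-Reasoning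
    1≤b₁ = subst (_≤ᵉ b 1) a-first (a≤b 1 ≤-refl (s≤s z≤n))

  -- There is a finite stair, since the top has height k′ > 0 and the last has height 0.
  1≤s : 1 ≤ s
  1≤s = n≢0⇒n>0 λ s≡0 → <⇒≢ 0<k′ (trans (sym (subst (λ t → p (suc t) ≡ 0) s≡0 p-last)) p₁≡k′)

  length-bound : ℓ ≤ᵉ fin h
  length-bound with stair∈profile 1≤s (n≤1+n s)
  ... | last-finite@(vaₛ , aₛ≤bₛ , _) with profile-witness last-finite
  ... | σ , σ∈P , constant =
    subst (_≤ᵉ fin h) (sym ℓ≡bₛ) (≤ᵉ-trans bₛ≤length (fin≤fin (proj₁ (proj₂ (lookup P⊆𝒫 σ∈P)))))
    where
    vbₛ = valid-mono vaₛ aₛ≤bₛ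
    0<pₛ : 0 < p s
    0<pₛ = subst (_< p s) p-last (p-step s 1≤s ≤-refl)
    bₛ≤length : b s ≤ᵉ fin (length σ)
    bₛ≤length = positive⇒≤length σ vbₛ
                  (subst (0 <_) (sym (constant (b s) (vbₛ , aₛ≤bₛ , ≤ᵉ-refl (b s)))) 0<pₛ)

lemma2p12 : (h k : ℕ) → 0 < h → 0 < k → (S : Triple → Set) →
    (InSS h k S →
       Σ (List (List ℕ)) λ P → P ≢ [] × All (InP h k) P × (S ≐ profile P) × IsStaircaseAny (profile P))
    × ((Σ (List (List ℕ)) λ P → P ≢ [] × All (InP h k) P × (S ≐ profile P) × IsStaircaseAny (profile P)) →
       InSS h k S)
lemma2p12 h k _ 0<k S = realise , bound
  where
  realise : InSS h k S →
    Σ (List (List ℕ)) λ P → P ≢ [] × All (InP h k) P × (S ≐ profile P) × IsStaircaseAny (profile P)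
  realise (ℓ , S-staircase , ℓ≤h) with staircase-realisable S-staircase ℓ≤h
  ... | P , P≢[] , P⊆𝒫 , S≐profile =
    P , P≢[] , P⊆𝒫 , S≐profile , ℓ , k , 0<k , staircase-resp S≐profile S-staircase

  bound : (Σ (List (List ℕ)) λ P → P ≢ [] × All (InP h k) P × (S ≐ profile P) × IsStaircaseAny (profile P)) →
    InSS h k S
  bound (P , _ , P⊆𝒫 , S≐profile , ℓ , k′ , 0<k′ , profile-staircase)
    with profile-staircase-bounds P⊆𝒫 0<k′ profile-staircase
  ... | refl , ℓ≤h = ℓ , staircase-resp (≐-sym S≐profile) profile-staircase , ℓ≤h
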